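{- Let $\mathcal{F}$ be a filter on a semigroup $G$, $n\ge1$, and $A,D\subseteq G$ such that $A$ is $n$-recurrent and $D$ is $n$-thick in $\Delta(A)$. Then $\Delta^n(A)\cap\Delta^{n-1}(D)$ is $\mathcal{F}$-positive; consequently $D$ is $(n-1)$-recurrent.
   Context: A filter $\mathcal{F}$ on $G$: nonempty family of subsets not containing $\emptyset$, closed upward and under finite intersections; $\mathcal{F}$-small means the complement is in $\mathcal{F}$; $\mathcal{F}$-positive means not $\mathcal{F}$-small; "$\exists^\mathcal{F} g\in D\,P(g)$" means $\{g\in D : P(g)\}$ is $\mathcal{F}$-positive. $\tilde A\precsim_\mathcal{F} A$ if $\tilde A\subseteq A$ and $A\setminus\tilde A$ is $\mathcal{F}$-small. $Ag^{ -1}:=\{x : xg\in A\}$, $\partial_gA := A\cap Ag^{ -1}$. Recurrence: $A$ is $0$-recurrent if $\mathcal{F}$-positive; $\Delta^0(A)=A$; for $n\ge1$, $\Delta^n(A) := \{g : \partial_gA \text{ is } (n-1)\text{ -recurrent}\}$, $A$ is $n$-recurrent if $\Delta^n(A)$ is $\mathcal{F}$-positive, $\Delta(A)=\Delta^1(A)$. Thickness: every $D$ is $0$-thick in $\Delta(A)$ for every $A$; for $n\ge1$, $D$ is $n$-thick in $\Delta(A)$ if for every $n$-recurrent $\tilde A\precsim_\mathcal{F} A$, $\exists^\mathcal{F} g\in D$ such that $\partial_g\tilde A$ is $(n-1)$-recurrent and $\partial_gD$ is $(n-1)$-thick in $\Delta(\partial_g\tilde A)$. -}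

module Defs where

open import Level using (Level; 0ℓ; _⊔_; Lift) renaming (suc to lsuc)
open import Data.Nat using (ℕ; zero; suc)
open import Data.Product using (Σ; _×_)
open import Data.Unit.Polymorphic using (⊤)
open import Data.Empty using (⊥)
open import Relation.Nullary using (¬_)
open import Relation.Unary using (Pred; _⊆_; _∩_)
open import Relation.Binary.PropositionalEquality using (_≡_)
open import Algebra.Structures using (IsSemigroup)

record Filter (G : Set) : Set₁ where
  field
    _∈F : Pred G 0ℓ → Set
    nonempty : Σ (Pred G 0ℓ) _∈F
    proper   : ¬ ((λ (_ : G) → ⊥) ∈F)
    upward   : ∀ {S T : Pred G 0ℓ} → S ⊆ T → S ∈F → T ∈F
    meet     : ∀ {S T : Pred G 0ℓ} → S ∈F → T ∈F → (S ∩ T) ∈F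

module Recurrence {G : Set} (_·_ : G → G → G)
                  (isSemigroup : IsSemigroup _≡_ _·_)
                  (𝓕 : Filter G) where
  open Filter 𝓕

  -- P is 𝓕-small iff its complement is in 𝓕; by upward closure this is
  -- the same as: some member of 𝓕 is disjoint from P.  The latter form is
  -- used so that predicates of any universe level can be measured.
  Small : ∀ {ℓ} → Pred G ℓ → Set (lsuc 0ℓ ⊔ ℓ)
  Small P = Σ (Pred G 0ℓ) λ S → (S ∈F) × (∀ g → S g → ¬ P g)

  Positive : ∀ {ℓ} → Pred G ℓ → Set (lsuc 0ℓ ⊔ ℓ)
  Positive P = ¬ Small P

  _g⁻¹[_] : ∀ {ℓ} → Pred G ℓ → G → Pred G ℓ
  (A g⁻¹[ g ]) x = A (x · g)

  ∂ : ∀ {ℓ} → G → Pred G ℓ → Pred G ℓ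
  ∂ g A = A ∩ (A g⁻¹[ g ])

  Δ^ : ∀ {ℓ} → ℕ → Pred G ℓ → Pred G (lsuc 0ℓ ⊔ ℓ)
  Recurrent : ∀ {ℓ} → ℕ → Pred G ℓ → Set (lsuc 0ℓ ⊔ ℓ)

  Δ^ zero A g = Lift (lsuc 0ℓ) (A g)
  Δ^ (suc n) A g = Recurrent n (∂ g A)
  Recurrent n A = Positive (Δ^ n A)

  _≾_ : Pred G 0ℓ → Pred G 0ℓ → Set₁
  Ã ≾ A = (Ã ⊆ A) × Small (λ g → A g × ¬ Ã g)

  -- Thick n D A : "D is n-thick in Δ(A)"
  Thick : ℕ → Pred G 0ℓ → Pred G 0ℓ → Set₁
  Thick zero D A = ⊤
  Thick (suc n) D A =
    ∀ (Ã : Pred G 0ℓ) → Ã ≾ A → Recurrent (suc n) Ã →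
      Positive (λ g → D g × Recurrent n (∂ g Ã) × Thick n (∂ g D) (∂ g Ã))

module Submission where

-- A ≾ A holds trivially, so thickness of D may be applied to
-- Ã = A itself: the set W of g ∈ D such that ∂_g A is n-recurrent and ∂_g D
-- is n-thick in Δ(∂_g A) is 𝓕-positive.  Every g ∈ W lies in Δⁿ⁺¹(A) by
-- definition, and also in Δⁿ(D): for n = 0 because g ∈ D, and for n = m+1
-- because the theorem at level m, applied to the pair (∂_g A, ∂_g D), makes
-- ∂_g D m-recurrent.  So W ⊆ Δⁿ⁺¹(A) ∩ Δⁿ(D), and positivity is inherited
-- by supersets.  The two claims are thus proved by a simultaneous induction
-- on n; recurrence of D is the projection of the first claim to Δⁿ(D).

open import Defs
open import Level using (0ℓ; lift) renaming (suc to lsuc)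
open import Data.Nat using (ℕ; suc; zero)
open import Data.Product using (_×_; _,_; proj₁; proj₂)
open import Relation.Unary using (Pred)
open import Relation.Binary.PropositionalEquality using (_≡_)
open import Algebra.Structures using (IsSemigroup)

module ThickRecurrence {G : Set} (_·_ : G → G → G) (isSg : IsSemigroup _≡_ _·_)
                       (𝓕 : Filter G) where
  open Recurrence _·_ isSg 𝓕
  open Filter 𝓕

  positive-mono : ∀ {a b} {P : Pred G a} {Q : Pred G b} →
                  (∀ g → P g → Q g) → Positive P → Positive Q
  positive-mono P⊆Q P-pos (S , S∈𝓕 , S∩Q=∅) =
    P-pos (S , S∈𝓕 , λ g Sg Pg → S∩Q=∅ g Sg (P⊆Q g Pg))

  ≾-refl : (A : Pred G 0ℓ) → A ≾ A
  ≾-refl A = (λ Ag → Ag) , (proj₁ nonempty , proj₂ nonempty , λ g _ (Ag , ¬Ag) → ¬Ag Ag)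

  Witness : ℕ → Pred G 0ℓ → Pred G 0ℓ → Pred G (lsuc 0ℓ)
  Witness n D A g = D g × Recurrent n (∂ g A) × Thick n (∂ g D) (∂ g A)

  witnesses-positive : ∀ n (A D : Pred G 0ℓ) →
                       Recurrent (suc n) A → Thick (suc n) D A →
                       Positive (Witness n D A)
  witnesses-positive n A D A-rec D-thick = D-thick A (≾-refl A) A-rec

  mutual
    Δ-intersection-positive : ∀ n (A D : Pred G 0ℓ) →
                              Recurrent (suc n) A → Thick (suc n) D A →
                              Positive (λ g → Δ^ (suc n) A g × Δ^ n D g)
    Δ-intersection-positive n A D A-rec D-thick =
      positive-mono (λ g w → proj₁ (proj₂ w) , witness∈Δ n A D g w)
                    (witnesses-positive n A D A-rec D-thick)

    witness∈Δ : ∀ n (A D : Pred G 0ℓ) g → Witness n D A g → Δ^ n D g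
    witness∈Δ zero    A D g (Dg , _) = lift Dg
    witness∈Δ (suc m) A D g (_ , ∂A-rec , ∂D-thick) =
      thick⇒recurrent m (∂ g A) (∂ g D) ∂A-rec ∂D-thick

    thick⇒recurrent : ∀ n (A D : Pred G 0ℓ) →
                      Recurrent (suc n) A → Thick (suc n) D A → Recurrent n D
    thick⇒recurrent n A D A-rec D-thick =
      positive-mono (λ g → proj₂) (Δ-intersection-positive n A D A-rec D-thick)

mainTheorem12 : {G : Set} (_·_ : G → G → G) (isSg : IsSemigroup _≡_ _·_) (𝓕 : Filter G)
    (n : ℕ) (A D : Pred G 0ℓ) →
    Recurrence.Recurrent _·_ isSg 𝓕 (suc n) A →
    Recurrence.Thick _·_ isSg 𝓕 (suc n) D A →
    Recurrence.Positive _·_ isSg 𝓕 (λ g → Recurrence.Δ^ _·_ isSg 𝓕 (suc n) A g × Recurrence.Δ^ _·_ isSg 𝓕 n D g)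
    × Recurrence.Recurrent _·_ isSg 𝓕 n D
mainTheorem12 _·_ isSg 𝓕 n A D A-rec D-thick =
  Δ-intersection-positive n A D A-rec D-thick , thick⇒recurrent n A D A-rec D-thick
  where open ThickRecurrence _·_ isSg 𝓕
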